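{- Call a finite word over $\{U,D\}$ (where $U=(1,1)$, $D=(1,-1)$) an admissible path if the lattice path it describes, starting at $(0,0)$, never goes below the $x$-axis and every maximal run of consecutive $D$-steps that ends on the $x$-axis has odd length. Then the generating function of all admissible paths (including the empty path), with $z$ marking the number of steps and regardless of the final level, equals $$\frac{1-z}{2}+\frac12\,\frac{1+z}{1-2z}\sqrt{1-4z^2}=1+z+2z^2+3z^3+5z^4+9z^5+16z^6+\cdots.$$
   Context: Admissible paths are the prefixes (partial paths) of Stanley's restricted Dyck paths, i.e. Dyck paths in which every maximal run of down-steps ending on the $x$-axis has odd length. -}

module Defs where

open import Data.Bool using (Bool; true; false; _∧_; if_then_else_)
open import Data.Nat using (ℕ; zero; suc)
open import Data.List using (List; []; _∷_; _++_; map)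
open import Data.Nat.ListAction using (sum)
open import Data.Integer using (ℤ; +_; _+_; _-_; _*_; -_)
open import Relation.Binary.PropositionalEquality using (_≡_)

data Step : Set where
  U D : Step

isOdd : ℕ → Bool
isOdd zero = false
isOdd (suc n) with isOdd n
... | true  = false
... | false = true

-- A maximal run of D-steps of length r has just ended at height h.
-- It is acceptable unless it ends on the x-axis (h = 0) with even length.
-- (r = 0 means there was no run.)
runOK : ℕ → ℕ → Bool
runOK h zero = true
runOK zero (suc r) = isOdd (suc r)
runOK (suc h) (suc r) = true

-- ok h r w : reading the remaining word w from current height h, where
-- the last r steps read were D-steps (r = length of the current D-run,
-- 0 if the previous step was U or nothing has been read), the path
-- never goes below the x-axis and every maximal D-run ending on the
-- x-axis has odd length.
ok : ℕ → ℕ → List Step → Bool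
ok h r [] = runOK h r
ok h r (U ∷ w) = runOK h r ∧ ok (suc h) 0 w
ok zero r (D ∷ w) = false
ok (suc h) r (D ∷ w) = ok h (suc r) w

admissible : List Step → Bool
admissible w = ok 0 0 w

words : ℕ → List (List Step)
words zero = [] ∷ []
words (suc n) = map (U ∷_) (words n) ++ map (D ∷_) (words n)

countAdm : ℕ → ℕ
countAdm n = sum (map (λ w → if admissible w then 1 else 0) (words n))

Series : Set
Series = ℕ → ℤ

-- Cauchy product: (a ⋆ b) n = Σ_{i=0}^{n} a i * b (n - i)
conv-aux : Series → Series → ℕ → ℕ → ℤ
conv-aux a b zero j = + 0
conv-aux a b (suc i) j = a i * b j + conv-aux a b i (suc j)

_⋆_ : Series → Series → Series
(a ⋆ b) n = conv-aux a b (suc n) 0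

_⊕_ : Series → Series → Series
(a ⊕ b) n = a n + b n

_⊖_ : Series → Series → Series
(a ⊖ b) n = a n - b n

-- polynomial given by its list of coefficients (constant term first)
poly : List ℤ → Series
poly [] n = + 0
poly (c ∷ cs) zero = c
poly (c ∷ cs) (suc n) = poly cs n

G : Series
G n = + countAdm n

IsSqrt1-4z² : Series → Set
IsSqrt1-4z² S = (S 0 ≡ + 1) × ((n : ℕ) → (S ⋆ S) n ≡ poly (+ 1 ∷ + 0 ∷ - (+ 4) ∷ []) n)
  where open import Data.Product using (_×_)

-- Write g n = countAdm n and C n for the number of Dyck paths with n steps, so that
-- C (n + 2) = Σ_{i+j=n} C i C j (first return) and √(1-4z²) = 1 - 2z² Σ C n zⁿ.
-- Appending U to an admissible path keeps it admissible; appending D fails exactly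
-- when the path ends on the axis (a restricted Dyck path; R n of these) or ends at
-- height 1 after an odd D-run (H n of these), so g (n + 1) = 2 g n - R n - H n.
-- With E and O counting Dyck paths whose last D-run is even resp. odd, cutting a
-- Dyck path at its last return after an even run, a restricted path at its first
-- return and an H-path at its last visit to the axis gives C = E·R, R = 1 + z²·E·R
-- and H = R·z·O; together with C = E + O this yields R (n + 2) = C n and
-- H (n + 2) = C (n + 1). The resulting recurrence
-- g (n + 3) = 2 g (n + 2) - C n - C (n + 1) is the coefficientwise form of
-- (1 - 2z)(2G - (1 - z)) = (1 + z)√(1-4z²). The square root is unique since the
-- coefficient of z^(n+1) in S² is 2 S (n + 1) plus terms in S 1, …, S n.

module Submission where

open import Defs
open import Data.Nat using (ℕ)
open import Data.Integer using (ℤ; +_; -_)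
open import Data.List using (List; []; _∷_)
open import Data.Product using (_×_; Σ)
open import Relation.Binary.PropositionalEquality using (_≡_)

open import Algebra.Bundles using (CommutativeSemiring)
open import Data.Bool using (Bool; true; false; not; _∧_; if_then_else_)
open import Data.Bool.Properties using (∧-identityʳ; ∧-zeroʳ)
open import Data.Integer as ℤ using ()
import Data.Integer.Properties as ℤ
open import Data.Integer.Tactic.RingSolver using (solve-∀)
open import Data.List using (_++_; map)
open import Data.List.Properties using (map-++; map-∘)
open import Data.Nat as ℕ using (zero; suc; 2+; _<_; s≤s)
import Data.Nat.Properties as ℕ
open import Data.Nat.Induction using (<-rec)
open import Data.Nat.ListAction using (sum)
open import Data.Nat.ListAction.Properties using (sum-++)
open import Data.Product using (_,_)
open import Function using (_∘_)
import Relation.Binary.PropositionalEquality as ≡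

module Convolution {c ℓ} (R : CommutativeSemiring c ℓ) where

  open CommutativeSemiring R
  open import Algebra.Properties.CommutativeSemigroup +-commutativeSemigroup using (interchange)
  open import Algebra.Properties.CommutativeSemigroup *-commutativeSemigroup
    using () renaming (interchange to *-interchange)
  open import Relation.Binary.Reasoning.Setoid setoid

  antidiagonalSum : ℕ → (ℕ → ℕ → Carrier) → Carrier
  antidiagonalSum zero    K = K 0 0
  antidiagonalSum (suc n) K = K 0 (suc n) + antidiagonalSum n (λ i j → K (suc i) j)

  antidiagonalSum-cong : ∀ n {K L : ℕ → ℕ → Carrier} →
    (∀ i j → i ℕ.+ j ≡ n → K i j ≈ L i j) → antidiagonalSum n K ≈ antidiagonalSum n L
  antidiagonalSum-cong zero    K≈L = K≈L 0 0 ≡.refl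
  antidiagonalSum-cong (suc n) K≈L = +-cong (K≈L 0 (suc n) ≡.refl)
    (antidiagonalSum-cong n (λ i j i+j≡n → K≈L (suc i) j (≡.cong suc i+j≡n)))

  antidiagonalSum-+ : ∀ n (K L : ℕ → ℕ → Carrier) →
    antidiagonalSum n (λ i j → K i j + L i j) ≈ antidiagonalSum n K + antidiagonalSum n L
  antidiagonalSum-+ zero    K L = refl
  antidiagonalSum-+ (suc n) K L =
    trans (+-congˡ (antidiagonalSum-+ n _ _)) (interchange _ _ _ _)

  antidiagonalSum-*ˡ : ∀ n x (K : ℕ → ℕ → Carrier) →
    antidiagonalSum n (λ i j → x * K i j) ≈ x * antidiagonalSum n K
  antidiagonalSum-*ˡ zero    x K = refl
  antidiagonalSum-*ˡ (suc n) x K =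
    trans (+-congˡ (antidiagonalSum-*ˡ n x _)) (sym (distribˡ x _ _))

  antidiagonalSum-last : ∀ n (K : ℕ → ℕ → Carrier) →
    antidiagonalSum (suc n) K ≈ antidiagonalSum n (λ i j → K i (suc j)) + K (suc n) 0
  antidiagonalSum-last zero    K = refl
  antidiagonalSum-last (suc n) K =
    trans (+-congˡ (antidiagonalSum-last n (λ i j → K (suc i) j))) (sym (+-assoc _ _ _))

  antidiagonalSum-transpose : ∀ n (K : ℕ → ℕ → Carrier) →
    antidiagonalSum n K ≈ antidiagonalSum n (λ i j → K j i)
  antidiagonalSum-transpose zero    K = refl
  antidiagonalSum-transpose (suc n) K = begin
    K 0 (suc n) + antidiagonalSum n (λ i j → K (suc i) j)
      ≈⟨ +-congˡ (antidiagonalSum-transpose n _) ⟩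
    K 0 (suc n) + antidiagonalSum n (λ i j → K (suc j) i)
      ≈⟨ +-comm _ _ ⟩
    antidiagonalSum n (λ i j → K (suc j) i) + K 0 (suc n)
      ≈⟨ antidiagonalSum-last n (λ i j → K j i) ⟨
    antidiagonalSum (suc n) (λ i j → K j i)
      ∎

  infixl 7 _∗_
  _∗_ : (ℕ → Carrier) → (ℕ → Carrier) → ℕ → Carrier
  (f ∗ g) n = antidiagonalSum n (λ i j → f i * g j)

  shift : (ℕ → Carrier) → ℕ → Carrier
  shift f zero    = 0#
  shift f (suc n) = f n

  ∗-congˡ : ∀ {f g : ℕ → Carrier} h → (∀ k → f k ≈ g k) →
            ∀ n → (f ∗ h) n ≈ (g ∗ h) n
  ∗-congˡ h f≈g n = antidiagonalSum-cong n (λ i j _ → *-congʳ (f≈g i))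

  ∗-congʳ : ∀ f {g h : ℕ → Carrier} → (∀ k → g k ≈ h k) →
            ∀ n → (f ∗ g) n ≈ (f ∗ h) n
  ∗-congʳ f g≈h n = antidiagonalSum-cong n (λ i j _ → *-congˡ (g≈h j))

  ∗-comm : ∀ f g n → (f ∗ g) n ≈ (g ∗ f) n
  ∗-comm f g n = trans (antidiagonalSum-transpose n _)
    (antidiagonalSum-cong n (λ i j _ → *-comm (f j) (g i)))

  ∗-distribʳ-+ : ∀ f g h n → ((λ k → f k + g k) ∗ h) n ≈ (f ∗ h) n + (g ∗ h) n
  ∗-distribʳ-+ f g h n = trans (antidiagonalSum-cong n (λ i j _ → distribʳ (h j) (f i) (g i)))
    (antidiagonalSum-+ n _ _)

  ∗-scale : ∀ a b f g n → ((λ k → a * f k) ∗ (λ k → b * g k)) n ≈ (a * b) * (f ∗ g) n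
  ∗-scale a b f g n = trans (antidiagonalSum-cong n (λ i j _ → *-interchange a (f i) b (g j)))
    (antidiagonalSum-*ˡ n (a * b) _)

  ∗-last : ∀ f g n → (f ∗ g) (suc n) ≈ (f ∗ (g ∘ suc)) n + f (suc n) * g 0
  ∗-last f g n = antidiagonalSum-last n (λ i j → f i * g j)

  ∗-shiftʳ : ∀ f g n → (f ∗ shift g) (suc n) ≈ (f ∗ g) n
  ∗-shiftʳ f g n = trans (∗-last f (shift g) n) (trans (+-congˡ (zeroʳ _)) (+-identityʳ _))

  ∗-ends : ∀ f g n → (f ∗ g) (suc (suc n)) ≈
    f 0 * g (suc (suc n)) + (((f ∘ suc) ∗ (g ∘ suc)) n + f (suc (suc n)) * g 0)
  ∗-ends f g n = +-congˡ (antidiagonalSum-last n (λ i j → f (suc i) * g j))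

-- Opened only now: inside Convolution these names would clash with the semiring's.
open import Data.Nat using (_+_; _*_)
open ≡ using (refl; sym; trans; cong; cong₂; subst; module ≡-Reasoning)
open import Algebra.Properties.CommutativeSemigroup ℕ.+-commutativeSemigroup
  using () renaming (interchange to +-interchange)

module ℕ∗ = Convolution ℕ.+-*-commutativeSemiring
open ℕ∗ using (antidiagonalSum; _∗_; shift)

⟦_⟧ : Bool → ℕ
⟦ b ⟧ = if b then 1 else 0

wordSum : ℕ → (List Step → ℕ) → ℕ
wordSum zero    f = f []
wordSum (suc n) f = wordSum n (f ∘ (U ∷_)) + wordSum n (f ∘ (D ∷_))

count : (List Step → Bool) → ℕ → ℕ
count P n = wordSum n (λ w → ⟦ P w ⟧)

sum-words : ∀ n (f : List Step → ℕ) → sum (map f (words n)) ≡ wordSum n f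
sum-words zero    f = ℕ.+-identityʳ (f [])
sum-words (suc n) f = begin
  sum (map f (map (U ∷_) (words n) ++ map (D ∷_) (words n)))
    ≡⟨ cong sum (map-++ f (map (U ∷_) (words n)) _) ⟩
  sum (map f (map (U ∷_) (words n)) ++ map f (map (D ∷_) (words n)))
    ≡⟨ sum-++ (map f (map (U ∷_) (words n))) _ ⟩
  sum (map f (map (U ∷_) (words n))) + sum (map f (map (D ∷_) (words n)))
    ≡⟨ cong₂ _+_ (cong sum (sym (map-∘ (words n)))) (cong sum (sym (map-∘ (words n)))) ⟩
  sum (map (f ∘ (U ∷_)) (words n)) + sum (map (f ∘ (D ∷_)) (words n))
    ≡⟨ cong₂ _+_ (sum-words n _) (sum-words n _) ⟩
  wordSum (suc n) f ∎
  where open ≡-Reasoning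

wordSum-cong : ∀ n {f g : List Step → ℕ} → (∀ w → f w ≡ g w) → wordSum n f ≡ wordSum n g
wordSum-cong zero    f≡g = f≡g []
wordSum-cong (suc n) f≡g =
  cong₂ _+_ (wordSum-cong n (f≡g ∘ (U ∷_))) (wordSum-cong n (f≡g ∘ (D ∷_)))

wordSum-zero : ∀ n → wordSum n (λ _ → 0) ≡ 0
wordSum-zero zero    = refl
wordSum-zero (suc n) = cong₂ _+_ (wordSum-zero n) (wordSum-zero n)

wordSum-+ : ∀ n (f g : List Step → ℕ) → wordSum n (λ w → f w + g w) ≡ wordSum n f + wordSum n g
wordSum-+ zero    f g = refl
wordSum-+ (suc n) f g = trans
  (cong₂ _+_ (wordSum-+ n (f ∘ (U ∷_)) (g ∘ (U ∷_)))
             (wordSum-+ n (f ∘ (D ∷_)) (g ∘ (D ∷_))))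
  (+-interchange (wordSum n (f ∘ (U ∷_))) _ _ _)

wordSum-*ˡ : ∀ n c (f : List Step → ℕ) → wordSum n (λ w → c * f w) ≡ c * wordSum n f
wordSum-*ˡ zero    c f = refl
wordSum-*ˡ (suc n) c f =
  trans (cong₂ _+_ (wordSum-*ˡ n c _) (wordSum-*ˡ n c _))
    (sym (ℕ.*-distribˡ-+ c (wordSum n (f ∘ (U ∷_))) _))

wordSum-*ʳ : ∀ n (f : List Step → ℕ) c → wordSum n (λ w → f w * c) ≡ wordSum n f * c
wordSum-*ʳ zero    f c = refl
wordSum-*ʳ (suc n) f c =
  trans (cong₂ _+_ (wordSum-*ʳ n _ c) (wordSum-*ʳ n _ c))
    (sym (ℕ.*-distribʳ-+ c (wordSum n (f ∘ (U ∷_))) _))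

wordSum-snoc : ∀ n (f : List Step → ℕ) →
  wordSum (suc n) f ≡ wordSum n (λ w → f (w ++ U ∷ []) + f (w ++ D ∷ []))
wordSum-snoc zero    f = refl
wordSum-snoc (suc n) f = cong₂ _+_ (wordSum-snoc n (f ∘ (U ∷_))) (wordSum-snoc n (f ∘ (D ∷_)))

splits : (List Step → List Step → ℕ) → List Step → ℕ
splits F []      = F [] []
splits F (x ∷ w) = F [] (x ∷ w) + splits (λ u v → F (x ∷ u) v) w

splits-zero : ∀ w → splits (λ _ _ → 0) w ≡ 0
splits-zero []      = refl
splits-zero (x ∷ w) = splits-zero w

wordSum-splits : ∀ n (F : List Step → List Step → ℕ) →
  wordSum n (splits F) ≡ antidiagonalSum n (λ i j → wordSum i (λ u → wordSum j (F u)))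
wordSum-splits zero    F = refl
wordSum-splits (suc n) F = begin
  wordSum n (λ w → F [] (U ∷ w) + splits (F ∘ (U ∷_)) w)
    + wordSum n (λ w → F [] (D ∷ w) + splits (F ∘ (D ∷_)) w)
    ≡⟨ cong₂ _+_ (wordSum-+ n _ _) (wordSum-+ n _ _) ⟩
  (wordSum n (F [] ∘ (U ∷_)) + wordSum n (splits (F ∘ (U ∷_))))
    + (wordSum n (F [] ∘ (D ∷_)) + wordSum n (splits (F ∘ (D ∷_))))
    ≡⟨ +-interchange (wordSum n (F [] ∘ (U ∷_))) _ _ _ ⟩
  wordSum (suc n) (F []) + (wordSum n (splits (F ∘ (U ∷_))) + wordSum n (splits (F ∘ (D ∷_))))
    ≡⟨ cong (_+_ (wordSum (suc n) (F []))) (cong₂ _+_ (wordSum-splits n _) (wordSum-splits n _)) ⟩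
  wordSum (suc n) (F []) + (antidiagonalSum n (λ i j → wordSum i (λ u → wordSum j (F (U ∷ u))))
                            + antidiagonalSum n (λ i j → wordSum i (λ u → wordSum j (F (D ∷ u)))))
    ≡⟨ cong (_+_ (wordSum (suc n) (F []))) (ℕ∗.antidiagonalSum-+ n _ _) ⟨
  antidiagonalSum (suc n) (λ i j → wordSum i (λ u → wordSum j (F u))) ∎
  where open ≡-Reasoning

infixr 6 _⊗_
_⊗_ : (List Step → Bool) → (List Step → Bool) → List Step → ℕ
P ⊗ Q = splits (λ u v → ⟦ P u ⟧ * ⟦ Q v ⟧)

count-⊗ : ∀ P Q n → wordSum n (P ⊗ Q) ≡ (count P ∗ count Q) n
count-⊗ P Q n = trans (wordSum-splits n _) (ℕ∗.antidiagonalSum-cong n (λ i j _ →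
  trans (wordSum-cong i (λ u → wordSum-*ˡ j ⟦ P u ⟧ _)) (wordSum-*ʳ i _ (count Q j))))

infixr 7 _◃_
_◃_ : Step → (List Step → Bool) → List Step → Bool
(U ◃ P) (U ∷ w) = P w
(D ◃ P) (D ∷ w) = P w
(_ ◃ P) _       = false

count-◃ : ∀ x P n → count (x ◃ P) n ≡ shift (count P) n
count-◃ U P zero    = refl
count-◃ D P zero    = refl
count-◃ U P (suc n) = trans (cong (_+_ (count P n)) (wordSum-zero n)) (ℕ.+-identityʳ _)
count-◃ D P (suc n) = cong (_+ count P n) (wordSum-zero n)

isZero : ℕ → Bool
isZero zero    = true
isZero (suc _) = false

dyck : ℕ → List Step → Bool
dyck h       []      = isZero h
dyck h       (U ∷ w) = dyck (suc h) w
dyck zero    (D ∷ w) = false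
dyck (suc h) (D ∷ w) = dyck h w

dyckLastRunOdd : Bool → ℕ → ℕ → List Step → Bool
dyckLastRunOdd b h       r []      = isZero h ∧ (if b then isOdd r else not (isOdd r))
dyckLastRunOdd b h       r (U ∷ w) = dyckLastRunOdd b (suc h) 0 w
dyckLastRunOdd b zero    r (D ∷ w) = false
dyckLastRunOdd b (suc h) r (D ∷ w) = dyckLastRunOdd b h (suc r) w

admissibleTo : (ℕ → ℕ → Bool) → ℕ → ℕ → List Step → Bool
admissibleTo F h       r []      = F h r
admissibleTo F h       r (U ∷ w) = runOK h r ∧ admissibleTo F (suc h) 0 w
admissibleTo F zero    r (D ∷ w) = false
admissibleTo F (suc h) r (D ∷ w) = admissibleTo F h (suc r) w

onAxis : ℕ → ℕ → Bool
onAxis zero    r = runOK zero r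
onAxis (suc h) r = false

atOneAfterOddRun : ℕ → ℕ → Bool
atOneAfterOddRun (suc zero) r = isOdd r
atOneAfterOddRun _          r = false

restricted blocked : ℕ → ℕ → List Step → Bool
restricted = admissibleTo onAxis
blocked    = admissibleTo atOneAfterOddRun

dyck-firstPassage : ∀ k w → (dyck k ⊗ D ◃ dyck 0) w ≡ ⟦ dyck (suc k) w ⟧
dyck-firstPassage k       []      = ℕ.*-zeroʳ ⟦ dyck k [] ⟧
dyck-firstPassage k       (U ∷ w) =
  cong₂ _+_ (ℕ.*-zeroʳ ⟦ dyck k [] ⟧) (dyck-firstPassage (suc k) w)
dyck-firstPassage zero    (D ∷ w) =
  trans (cong₂ _+_ (ℕ.+-identityʳ _) (splits-zero w)) (ℕ.+-identityʳ _)
dyck-firstPassage (suc k) (D ∷ w) = dyck-firstPassage k w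

dyck-lastRunParity : ∀ k r w →
  ⟦ dyck k w ⟧ ≡ ⟦ dyckLastRunOdd false k r w ⟧ + ⟦ dyckLastRunOdd true k r w ⟧
dyck-lastRunParity zero    r [] with isOdd r
... | true  = refl
... | false = refl
dyck-lastRunParity (suc k) r []      = refl
dyck-lastRunParity k       r (U ∷ w) = dyck-lastRunParity (suc k) 0 w
dyck-lastRunParity zero    r (D ∷ w) = refl
dyck-lastRunParity (suc k) r (D ∷ w) = dyck-lastRunParity k (suc r) w

restricted-onAxis : ∀ r w → restricted 0 r w ≡ runOK 0 r ∧ restricted 0 0 w
restricted-onAxis r []      = sym (∧-identityʳ (runOK 0 r))
restricted-onAxis r (U ∷ w) = refl
restricted-onAxis r (D ∷ w) = sym (∧-zeroʳ (runOK 0 r))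

restrictedPastStart : ℕ → ℕ → List Step → Bool
restrictedPastStart zero zero _ = false
restrictedPastStart h    r    w = restricted h r w

-- (h, r) is the state reached after a prefix p of a Dyck path p ++ w. The right
-- summand counts the cuts lying in w; the left one the only cut inside p that
-- can work (its last even return), which exists unless p is empty.
dyck-lastEvenReturn : ∀ h r w →
  ⟦ restrictedPastStart h r w ⟧ + (dyckLastRunOdd false h r ⊗ restricted 0 0) w ≡ ⟦ dyck h w ⟧
dyck-lastEvenReturn zero    zero    []      = refl
dyck-lastEvenReturn zero    (suc r) []      with isOdd r
... | true  = refl
... | false = refl
dyck-lastEvenReturn (suc h) zero    []      = refl
dyck-lastEvenReturn (suc h) (suc r) []      = refl
dyck-lastEvenReturn zero    zero    (U ∷ w)
  rewrite ℕ.+-identityʳ ⟦ restricted 1 0 w ⟧ = dyck-lastEvenReturn 1 0 w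
dyck-lastEvenReturn zero    (suc r) (U ∷ w) with isOdd r
... | true  rewrite ℕ.+-identityʳ ⟦ restricted 1 0 w ⟧ = dyck-lastEvenReturn 1 0 w
... | false = dyck-lastEvenReturn 1 0 w
dyck-lastEvenReturn (suc h) zero    (U ∷ w) = dyck-lastEvenReturn (suc (suc h)) 0 w
dyck-lastEvenReturn (suc h) (suc r) (U ∷ w) = dyck-lastEvenReturn (suc (suc h)) 0 w
dyck-lastEvenReturn zero    zero    (D ∷ w) = splits-zero w
dyck-lastEvenReturn zero    (suc r) (D ∷ w) =
  cong₂ _+_ (ℕ.*-zeroʳ ⟦ not (isOdd (suc r)) ⟧) (splits-zero w)
dyck-lastEvenReturn (suc zero)    r (D ∷ w) = dyck-lastEvenReturn zero (suc r) w
dyck-lastEvenReturn (suc (suc h)) r (D ∷ w) = dyck-lastEvenReturn (suc h) (suc r) w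

restricted-firstReturn : ∀ k r w →
  (dyckLastRunOdd false k r ⊗ D ◃ restricted 0 0) w ≡ ⟦ restricted (suc k) r w ⟧
restricted-firstReturn k       r       []      = ℕ.*-zeroʳ ⟦ dyckLastRunOdd false k r [] ⟧
restricted-firstReturn k       zero    (U ∷ w) =
  cong₂ _+_ (ℕ.*-zeroʳ ⟦ dyckLastRunOdd false k 0 [] ⟧) (restricted-firstReturn (suc k) 0 w)
restricted-firstReturn k       (suc r) (U ∷ w) =
  cong₂ _+_ (ℕ.*-zeroʳ ⟦ dyckLastRunOdd false k (suc r) [] ⟧) (restricted-firstReturn (suc k) 0 w)
restricted-firstReturn zero    r       (D ∷ w) rewrite restricted-onAxis (suc r) w with isOdd r
... | true  = splits-zero w
... | false = trans (cong₂ _+_ (ℕ.+-identityʳ _) (splits-zero w)) (ℕ.+-identityʳ _)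
restricted-firstReturn (suc k) r       (D ∷ w) = restricted-firstReturn k (suc r) w

liftedOddDyck : ℕ → ℕ → List Step → Bool
liftedOddDyck zero    _ _ = false
liftedOddDyck (suc h) r w = dyckLastRunOdd true h r w

-- As for dyck-lastEvenReturn: the left summand counts the cut inside the prefix
-- already read, which is possible only if that prefix has left the axis.
blocked-lastVisit : ∀ h r w →
  ⟦ liftedOddDyck h r w ⟧ + (restricted h r ⊗ U ◃ dyckLastRunOdd true 0 0) w
    ≡ ⟦ blocked h r w ⟧
blocked-lastVisit zero          r       []      = ℕ.*-zeroʳ ⟦ restricted 0 r [] ⟧
blocked-lastVisit (suc zero)    r       []      = ℕ.+-identityʳ ⟦ isOdd r ⟧
blocked-lastVisit (suc (suc h)) r       []      = refl
blocked-lastVisit zero          r       (U ∷ w) with runOK 0 r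
... | true  rewrite ℕ.+-identityʳ ⟦ dyckLastRunOdd true 0 0 w ⟧ = blocked-lastVisit 1 0 w
... | false = splits-zero w
blocked-lastVisit (suc h)       zero    (U ∷ w) = blocked-lastVisit (suc (suc h)) 0 w
blocked-lastVisit (suc h)       (suc r) (U ∷ w) = blocked-lastVisit (suc (suc h)) 0 w
blocked-lastVisit zero          r       (D ∷ w) =
  cong₂ _+_ (ℕ.*-zeroʳ ⟦ restricted 0 r [] ⟧) (splits-zero w)
blocked-lastVisit (suc zero)    r       (D ∷ w) = blocked-lastVisit zero (suc r) w
blocked-lastVisit (suc (suc h)) r       (D ∷ w) = blocked-lastVisit (suc h) (suc r) w

admissible-lastStep : ∀ h r w →
  ⟦ ok h r (w ++ U ∷ []) ⟧ + ⟦ ok h r (w ++ D ∷ []) ⟧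
    + (⟦ restricted h r w ⟧ + ⟦ blocked h r w ⟧)
    ≡ ⟦ ok h r w ⟧ + ⟦ ok h r w ⟧
admissible-lastStep zero          zero    [] = refl
admissible-lastStep zero          (suc r) [] with isOdd r
... | true  = refl
... | false = refl
admissible-lastStep (suc zero)    zero    [] = refl
admissible-lastStep (suc zero)    (suc r) [] with isOdd r
... | true  = refl
... | false = refl
admissible-lastStep (suc (suc h)) zero    [] = refl
admissible-lastStep (suc (suc h)) (suc r) [] = refl
admissible-lastStep h             r       (U ∷ w) with runOK h r
... | true  = admissible-lastStep (suc h) 0 w
... | false = refl
admissible-lastStep zero          r       (D ∷ w) = refl
admissible-lastStep (suc h)       r       (D ∷ w) = admissible-lastStep h (suc r) w

-- Paths are counted by length, not semilength: catalan (2 * m) is the m-th Catalan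
-- number and catalan vanishes at odd arguments.
catalan evenDyck oddDyck restrictedCount blockedCount : ℕ → ℕ
catalan         = count (dyck 0)
evenDyck        = count (dyckLastRunOdd false 0 0)
oddDyck         = count (dyckLastRunOdd true 0 0)
restrictedCount = count (restricted 0 0)
blockedCount    = count (blocked 0 0)

count-fromAxis : ∀ P n → (∀ w → P (D ∷ w) ≡ false) →
  count P (suc n) ≡ count (P ∘ (U ∷_)) n
count-fromAxis P n noDown = trans (cong (_+_ (count (P ∘ (U ∷_)) n))
  (trans (wordSum-cong n (λ w → cong ⟦_⟧ (noDown w))) (wordSum-zero n))) (ℕ.+-identityʳ _)

catalan-rec : ∀ n → catalan (2+ n) ≡ (catalan ∗ catalan) n
catalan-rec n = begin
  catalan (2+ n)                          ≡⟨ count-fromAxis (dyck 0) (suc n) (λ _ → refl) ⟩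
  count (dyck 1) (suc n)                  ≡⟨ wordSum-cong (suc n) (dyck-firstPassage 0) ⟨
  wordSum (suc n) (dyck 0 ⊗ D ◃ dyck 0)   ≡⟨ count-⊗ (dyck 0) (D ◃ dyck 0) (suc n) ⟩
  (catalan ∗ count (D ◃ dyck 0)) (suc n)  ≡⟨ ℕ∗.∗-congʳ catalan (count-◃ D (dyck 0)) (suc n) ⟩
  (catalan ∗ shift catalan) (suc n)       ≡⟨ ℕ∗.∗-shiftʳ catalan catalan n ⟩
  (catalan ∗ catalan) n                   ∎
  where open ≡-Reasoning

catalan-byLastRun : ∀ n → catalan n ≡ evenDyck n + oddDyck n
catalan-byLastRun n = trans (wordSum-cong n (dyck-lastRunParity 0 0)) (wordSum-+ n _ _)

catalan-factor : ∀ n → catalan n ≡ (evenDyck ∗ restrictedCount) n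
catalan-factor n = trans (wordSum-cong n (λ w → sym (dyck-lastEvenReturn 0 0 w)))
  (count-⊗ (dyckLastRunOdd false 0 0) (restricted 0 0) n)

restrictedCount-rec : ∀ n → restrictedCount (2+ n) ≡ catalan n
restrictedCount-rec n = begin
  restrictedCount (2+ n)
    ≡⟨ count-fromAxis (restricted 0 0) (suc n) (λ _ → refl) ⟩
  count (restricted 1 0) (suc n)
    ≡⟨ wordSum-cong (suc n) (restricted-firstReturn 0 0) ⟨
  wordSum (suc n) (dyckLastRunOdd false 0 0 ⊗ D ◃ restricted 0 0)
    ≡⟨ count-⊗ (dyckLastRunOdd false 0 0) (D ◃ restricted 0 0) (suc n) ⟩
  (evenDyck ∗ count (D ◃ restricted 0 0)) (suc n)
    ≡⟨ ℕ∗.∗-congʳ evenDyck (count-◃ D (restricted 0 0)) (suc n) ⟩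
  (evenDyck ∗ shift restrictedCount) (suc n)    ≡⟨ ℕ∗.∗-shiftʳ evenDyck restrictedCount n ⟩
  (evenDyck ∗ restrictedCount) n                ≡⟨ catalan-factor n ⟨
  catalan n                                     ∎
  where open ≡-Reasoning

∗-restrictedCount : ∀ f n → (f ∗ restrictedCount) (2+ n) ≡ f (2+ n) + (f ∗ catalan) n
∗-restrictedCount f n = begin
  (f ∗ restrictedCount) (2+ n)                          ≡⟨ ℕ∗.∗-last f restrictedCount (suc n) ⟩
  (f ∗ (restrictedCount ∘ suc)) (suc n) + f (2+ n) * 1  ≡⟨ cong₂ _+_ tail (ℕ.*-identityʳ _) ⟩
  (f ∗ catalan) n + f (2+ n)                            ≡⟨ ℕ.+-comm _ (f (2+ n)) ⟩
  f (2+ n) + (f ∗ catalan) n                            ∎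
  where
  open ≡-Reasoning
  R∘suc≡z·C : ∀ k → restrictedCount (suc k) ≡ shift catalan k
  R∘suc≡z·C zero    = refl
  R∘suc≡z·C (suc k) = restrictedCount-rec k
  tail : (f ∗ (restrictedCount ∘ suc)) (suc n) ≡ (f ∗ catalan) n
  tail = trans (ℕ∗.∗-congʳ f R∘suc≡z·C (suc n)) (ℕ∗.∗-shiftʳ f catalan n)

blockedCount-factor : ∀ n → blockedCount n ≡ (restrictedCount ∗ shift oddDyck) n
blockedCount-factor n = begin
  blockedCount n                                     ≡⟨ wordSum-cong n (blocked-lastVisit 0 0) ⟨
  wordSum n (restricted 0 0 ⊗ U ◃ dyckLastRunOdd true 0 0)
    ≡⟨ count-⊗ (restricted 0 0) (U ◃ dyckLastRunOdd true 0 0) n ⟩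
  (restrictedCount ∗ count (U ◃ dyckLastRunOdd true 0 0)) n
    ≡⟨ ℕ∗.∗-congʳ restrictedCount (count-◃ U (dyckLastRunOdd true 0 0)) n ⟩
  (restrictedCount ∗ shift oddDyck) n                ∎
  where open ≡-Reasoning

oddDyck∗restrictedCount : ∀ n → (oddDyck ∗ restrictedCount) (suc n) ≡ catalan (suc n)
oddDyck∗restrictedCount zero    = refl
oddDyck∗restrictedCount (suc n) = ℕ.+-cancelʳ-≡ (catalan (2+ n)) _ _ (begin
  (oddDyck ∗ restrictedCount) (2+ n) + catalan (2+ n)
    ≡⟨ cong (_+_ ((oddDyck ∗ restrictedCount) (2+ n))) (catalan-factor (2+ n)) ⟩
  (oddDyck ∗ restrictedCount) (2+ n) + (evenDyck ∗ restrictedCount) (2+ n)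
    ≡⟨ ℕ∗.∗-distribʳ-+ oddDyck evenDyck restrictedCount (2+ n) ⟨
  ((λ k → oddDyck k + evenDyck k) ∗ restrictedCount) (2+ n)
    ≡⟨ ℕ∗.∗-congˡ restrictedCount
         (λ k → trans (ℕ.+-comm (oddDyck k) _) (sym (catalan-byLastRun k))) (2+ n) ⟩
  (catalan ∗ restrictedCount) (2+ n)    ≡⟨ ∗-restrictedCount catalan n ⟩
  catalan (2+ n) + (catalan ∗ catalan) n ≡⟨ cong (_+_ (catalan (2+ n))) (catalan-rec n) ⟨
  catalan (2+ n) + catalan (2+ n)        ∎)
  where open ≡-Reasoning

blockedCount-rec : ∀ n → blockedCount (2+ n) ≡ catalan (suc n)
blockedCount-rec n = begin
  blockedCount (2+ n)                       ≡⟨ blockedCount-factor (2+ n) ⟩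
  (restrictedCount ∗ shift oddDyck) (2+ n)  ≡⟨ ℕ∗.∗-shiftʳ restrictedCount oddDyck (suc n) ⟩
  (restrictedCount ∗ oddDyck) (suc n)       ≡⟨ ℕ∗.∗-comm restrictedCount oddDyck (suc n) ⟩
  (oddDyck ∗ restrictedCount) (suc n)       ≡⟨ oddDyck∗restrictedCount n ⟩
  catalan (suc n)                           ∎
  where open ≡-Reasoning

countAdm≡count : ∀ n → countAdm n ≡ count (ok 0 0) n
countAdm≡count n = sum-words n (λ w → ⟦ ok 0 0 w ⟧)

countAdm-lastStep : ∀ n →
  countAdm (suc n) + (restrictedCount n + blockedCount n) ≡ countAdm n + countAdm n
countAdm-lastStep n = begin
  countAdm (suc n) + (restrictedCount n + blockedCount n)
    ≡⟨ cong₂ _+_ (trans (countAdm≡count (suc n)) (wordSum-snoc n (λ w → ⟦ ok 0 0 w ⟧)))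
                 (sym (wordSum-+ n (λ w → ⟦ restricted 0 0 w ⟧) _)) ⟩
  wordSum n (λ w → ⟦ ok 0 0 (w ++ U ∷ []) ⟧ + ⟦ ok 0 0 (w ++ D ∷ []) ⟧)
    + wordSum n (λ w → ⟦ restricted 0 0 w ⟧ + ⟦ blocked 0 0 w ⟧)
    ≡⟨ wordSum-+ n _ _ ⟨
  wordSum n (λ w → ⟦ ok 0 0 (w ++ U ∷ []) ⟧ + ⟦ ok 0 0 (w ++ D ∷ []) ⟧
                   + (⟦ restricted 0 0 w ⟧ + ⟦ blocked 0 0 w ⟧))
    ≡⟨ wordSum-cong n (admissible-lastStep 0 0) ⟩
  wordSum n (λ w → ⟦ ok 0 0 w ⟧ + ⟦ ok 0 0 w ⟧)  ≡⟨ wordSum-+ n _ _ ⟩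
  count (ok 0 0) n + count (ok 0 0) n
    ≡⟨ cong₂ _+_ (countAdm≡count n) (countAdm≡count n) ⟨
  countAdm n + countAdm n                        ∎
  where open ≡-Reasoning

countAdm-rec : ∀ n →
  countAdm (suc (2+ n)) + (catalan n + catalan (suc n)) ≡ countAdm (2+ n) + countAdm (2+ n)
countAdm-rec n = begin
  countAdm (suc (2+ n)) + (catalan n + catalan (suc n))
    ≡⟨ cong (_+_ (countAdm (suc (2+ n)))) (cong₂ _+_ (restrictedCount-rec n) (blockedCount-rec n)) ⟨
  countAdm (suc (2+ n)) + (restrictedCount (2+ n) + blockedCount (2+ n))
    ≡⟨ countAdm-lastStep (2+ n) ⟩
  countAdm (2+ n) + countAdm (2+ n) ∎
  where open ≡-Reasoning

module ℤ∗ = Convolution ℤ.+-*-commutativeSemiring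
open ℤ∗ using () renaming (_∗_ to _∗ᶻ_)

conv-aux≡antidiagonalSum : ∀ (a b : Series) n j →
  conv-aux a b (suc n) j ≡ ℤ∗.antidiagonalSum n (λ p q → a q ℤ.* b (p + j))
conv-aux≡antidiagonalSum a b zero    j = ℤ.+-identityʳ _
conv-aux≡antidiagonalSum a b (suc n) j = cong (ℤ._+_ (a (suc n) ℤ.* b j))
  (trans (conv-aux≡antidiagonalSum a b n (suc j))
         (ℤ∗.antidiagonalSum-cong n (λ p q _ → cong (λ t → a q ℤ.* b t) (ℕ.+-suc p j))))

⋆≡∗ : ∀ (a b : Series) n → (a ⋆ b) n ≡ (a ∗ᶻ b) n
⋆≡∗ a b n = begin
  (a ⋆ b) n
    ≡⟨ conv-aux≡antidiagonalSum a b n 0 ⟩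
  ℤ∗.antidiagonalSum n (λ p q → a q ℤ.* b (p + 0))
    ≡⟨ ℤ∗.antidiagonalSum-cong n (λ p q _ → cong (λ t → a q ℤ.* b t) (ℕ.+-identityʳ p)) ⟩
  ℤ∗.antidiagonalSum n (λ p q → a q ℤ.* b p)
    ≡⟨ ℤ∗.antidiagonalSum-transpose n _ ⟨
  (a ∗ᶻ b) n
    ∎
  where open ≡-Reasoning

⋆-congʳ : ∀ (a : Series) {b c : Series} → (∀ k → b k ≡ c k) →
  ∀ n → (a ⋆ b) n ≡ (a ⋆ c) n
⋆-congʳ a {b} {c} b≡c n = go (suc n) 0
  where
  go : ∀ i j → conv-aux a b i j ≡ conv-aux a c i j
  go zero    j = refl
  go (suc i) j = cong₂ ℤ._+_ (cong (ℤ._*_ (a i)) (b≡c j)) (go i (suc j))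

⋆-linear : ∀ a b (f : Series) k →
  (poly (a ∷ b ∷ []) ⋆ f) (suc k) ≡ b ℤ.* f k ℤ.+ (a ℤ.* f (suc k) ℤ.+ + 0)
⋆-linear a b f k = trans (go k 0) (cong (conv-aux p f 2) (ℕ.+-identityʳ k))
  where
  p = poly (a ∷ b ∷ [])
  go : ∀ k j → conv-aux p f (2+ k) j ≡ conv-aux p f 2 (k + j)
  go zero    j = refl
  go (suc k) j = trans (ℤ.+-identityˡ _) (trans (go k (suc j)) (cong (conv-aux p f 2) (ℕ.+-suc k j)))

pos-antidiagonalSum : ∀ n (K : ℕ → ℕ → ℕ) →
  + antidiagonalSum n K ≡ ℤ∗.antidiagonalSum n (λ i j → + K i j)
pos-antidiagonalSum zero    K = refl
pos-antidiagonalSum (suc n) K = cong (ℤ._+_ (+ K 0 (suc n))) (pos-antidiagonalSum n _)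

pos-∗ : ∀ f g n → + (f ∗ g) n ≡ ((+_ ∘ f) ∗ᶻ (+_ ∘ g)) n
pos-∗ f g n = trans (pos-antidiagonalSum n _)
  (ℤ∗.antidiagonalSum-cong n (λ i j _ → ℤ.pos-* (f i) (g j)))

innerSquare : Series → ℕ → ℤ
innerSquare f zero    = + 0
innerSquare f (suc n) = ((f ∘ suc) ∗ᶻ (f ∘ suc)) n

∗-square-suc : ∀ f n → f 0 ≡ + 1 →
  (f ∗ᶻ f) (suc n) ≡ + 1 ℤ.* f (suc n) ℤ.+ (innerSquare f n ℤ.+ f (suc n) ℤ.* + 1)
∗-square-suc f zero    f₀ rewrite f₀ = cong (ℤ._+_ (+ 1 ℤ.* f 1)) (sym (ℤ.+-identityˡ _))
∗-square-suc f (suc n) f₀ = trans (ℤ∗.∗-ends f f n)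
  (cong (λ x → x ℤ.* f (2+ n) ℤ.+ (innerSquare f (suc n) ℤ.+ f (2+ n) ℤ.* x)) f₀)

innerSquare-cong : ∀ {f g : Series} n → (∀ {k} → k < suc n → f k ≡ g k) →
  innerSquare f n ≡ innerSquare g n
innerSquare-cong zero    _   = refl
innerSquare-cong (suc n) f≡g = ℤ∗.antidiagonalSum-cong n (λ i j i+j≡n →
  cong₂ ℤ._*_ (f≡g (s≤s (s≤s (subst (i ℕ.≤_) i+j≡n (ℕ.m≤m+n i j)))))
              (f≡g (s≤s (s≤s (subst (j ℕ.≤_) i+j≡n (ℕ.m≤n+m j i))))))

√1-4z² : Series
√1-4z² zero       = + 1
√1-4z² (suc zero) = + 0
√1-4z² (2+ n)     = - (+ 2) ℤ.* + catalan n

innerSquare-√1-4z² : ∀ k → innerSquare √1-4z² (suc (2+ k)) ≡ + 4 ℤ.* + catalan (2+ k)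
innerSquare-√1-4z² k = begin
  ((√1-4z² ∘ suc) ∗ᶻ (√1-4z² ∘ suc)) (2+ k)
    ≡⟨ ℤ∗.∗-ends (√1-4z² ∘ suc) (√1-4z² ∘ suc) k ⟩
  + 0 ℤ.* s ℤ.+ (((√1-4z² ∘ suc ∘ suc) ∗ᶻ (√1-4z² ∘ suc ∘ suc)) k ℤ.+ s ℤ.* + 0)
    ≡⟨ drop-zeros s _ ⟩
  ((λ j → - (+ 2) ℤ.* + catalan j) ∗ᶻ (λ j → - (+ 2) ℤ.* + catalan j)) k
    ≡⟨ ℤ∗.∗-scale (- (+ 2)) (- (+ 2)) (+_ ∘ catalan) (+_ ∘ catalan) k ⟩
  + 4 ℤ.* ((+_ ∘ catalan) ∗ᶻ (+_ ∘ catalan)) k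
    ≡⟨ cong (ℤ._*_ (+ 4)) (pos-∗ catalan catalan k) ⟨
  + 4 ℤ.* + (catalan ∗ catalan) k
    ≡⟨ cong (λ t → + 4 ℤ.* + t) (catalan-rec k) ⟨
  + 4 ℤ.* + catalan (2+ k)                                  ∎
  where
  open ≡-Reasoning
  s = √1-4z² (suc (2+ k))
  drop-zeros : ∀ s x → + 0 ℤ.* s ℤ.+ (x ℤ.+ s ℤ.* + 0) ≡ x
  drop-zeros = solve-∀

√1-4z²-squared : ∀ n → (√1-4z² ⋆ √1-4z²) n ≡ poly (+ 1 ∷ + 0 ∷ - (+ 4) ∷ []) n
√1-4z²-squared 0 = refl
√1-4z²-squared 1 = refl
√1-4z²-squared 2 = refl
√1-4z²-squared 3 = refl
√1-4z²-squared (suc (suc (2+ k))) = begin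
  (√1-4z² ⋆ √1-4z²) (suc (suc (2+ k)))   ≡⟨ ⋆≡∗ √1-4z² √1-4z² (suc (suc (2+ k))) ⟩
  (√1-4z² ∗ᶻ √1-4z²) (suc (suc (2+ k)))  ≡⟨ ∗-square-suc √1-4z² (suc (2+ k)) refl ⟩
  + 1 ℤ.* (- (+ 2) ℤ.* c) ℤ.+ (innerSquare √1-4z² (suc (2+ k)) ℤ.+ (- (+ 2) ℤ.* c) ℤ.* + 1)
    ≡⟨ cong (λ t → + 1 ℤ.* (- (+ 2) ℤ.* c) ℤ.+ (t ℤ.+ (- (+ 2) ℤ.* c) ℤ.* + 1))
            (innerSquare-√1-4z² k) ⟩
  + 1 ℤ.* (- (+ 2) ℤ.* c) ℤ.+ (+ 4 ℤ.* c ℤ.+ (- (+ 2) ℤ.* c) ℤ.* + 1)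
    ≡⟨ cancel c ⟩
  + 0                                    ∎
  where
  open ≡-Reasoning
  c = + catalan (2+ k)
  cancel : ∀ c →
    + 1 ℤ.* (- (+ 2) ℤ.* c) ℤ.+ (+ 4 ℤ.* c ℤ.+ (- (+ 2) ℤ.* c) ℤ.* + 1) ≡ + 0
  cancel = solve-∀

doubling-injective : ∀ m x y →
  + 1 ℤ.* x ℤ.+ (m ℤ.+ x ℤ.* + 1) ≡ + 1 ℤ.* y ℤ.+ (m ℤ.+ y ℤ.* + 1) → x ≡ y
doubling-injective m x y eq = ℤ.*-cancelˡ-≡ (+ 2) x y (begin
  + 2 ℤ.* x                                ≡⟨ twice m x ⟩
  (+ 1 ℤ.* x ℤ.+ (m ℤ.+ x ℤ.* + 1)) ℤ.- m  ≡⟨ cong (ℤ._- m) eq ⟩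
  (+ 1 ℤ.* y ℤ.+ (m ℤ.+ y ℤ.* + 1)) ℤ.- m  ≡⟨ twice m y ⟨
  + 2 ℤ.* y                                ∎)
  where
  open ≡-Reasoning
  twice : ∀ m x → + 2 ℤ.* x ≡ (+ 1 ℤ.* x ℤ.+ (m ℤ.+ x ℤ.* + 1)) ℤ.- m
  twice = solve-∀

isSqrt1-4z²-unique : ∀ {S T : Series} → IsSqrt1-4z² S → IsSqrt1-4z² T → ∀ n → S n ≡ T n
isSqrt1-4z²-unique {S} {T} (S₀ , S²) (T₀ , T²) = <-rec (λ n → S n ≡ T n) agree
  where
  open ≡-Reasoning
  agree : ∀ n → (∀ {k} → k < n → S k ≡ T k) → S n ≡ T n
  agree zero    _      = trans S₀ (sym T₀)
  agree (suc n) S≡T<n = doubling-injective (innerSquare T n) (S (suc n)) (T (suc n)) (begin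
    + 1 ℤ.* S (suc n) ℤ.+ (innerSquare T n ℤ.+ S (suc n) ℤ.* + 1)
      ≡⟨ cong (λ t → + 1 ℤ.* S (suc n) ℤ.+ (t ℤ.+ S (suc n) ℤ.* + 1))
              (innerSquare-cong n S≡T<n) ⟨
    + 1 ℤ.* S (suc n) ℤ.+ (innerSquare S n ℤ.+ S (suc n) ℤ.* + 1)
      ≡⟨ ∗-square-suc S n S₀ ⟨
    (S ∗ᶻ S) (suc n)  ≡⟨ ⋆≡∗ S S (suc n) ⟨
    (S ⋆ S) (suc n)   ≡⟨ trans (S² (suc n)) (sym (T² (suc n))) ⟩
    (T ⋆ T) (suc n)   ≡⟨ ⋆≡∗ T T (suc n) ⟩
    (T ∗ᶻ T) (suc n)  ≡⟨ ∗-square-suc T n T₀ ⟩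
    + 1 ℤ.* T (suc n) ℤ.+ (innerSquare T n ℤ.+ T (suc n) ℤ.* + 1) ∎)

admissible-gf : ∀ n → (poly (+ 1 ∷ - (+ 2) ∷ []) ⋆ ((G ⊕ G) ⊖ poly (+ 1 ∷ - (+ 1) ∷ []))) n
                        ≡ (poly (+ 1 ∷ + 1 ∷ []) ⋆ √1-4z²) n
admissible-gf zero    = refl
admissible-gf (suc k) = trans (⋆-linear _ _ _ k) (trans (coefficient k) (sym (⋆-linear _ _ _ k)))
  where
  open ≡-Reasoning
  T : Series
  T = (G ⊕ G) ⊖ poly (+ 1 ∷ - (+ 1) ∷ [])
  coefficient : ∀ k → - (+ 2) ℤ.* T k ℤ.+ (+ 1 ℤ.* T (suc k) ℤ.+ + 0)
                        ≡ + 1 ℤ.* √1-4z² k ℤ.+ (+ 1 ℤ.* √1-4z² (suc k) ℤ.+ + 0)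
  coefficient zero       = refl
  coefficient (suc zero) = refl
  coefficient (2+ m)     = begin
    - (+ 2) ℤ.* ((a ℤ.+ a) ℤ.- + 0) ℤ.+ (+ 1 ℤ.* ((b ℤ.+ b) ℤ.- + 0) ℤ.+ + 0)
      ≡⟨ lhs a b ⟩
    - (+ 2) ℤ.* (a ℤ.+ a) ℤ.+ + 2 ℤ.* b
      ≡⟨ cong (λ t → - (+ 2) ℤ.* t ℤ.+ + 2 ℤ.* b) (cong +_ (countAdm-rec m)) ⟨
    - (+ 2) ℤ.* (b ℤ.+ (c₀ ℤ.+ c₁)) ℤ.+ + 2 ℤ.* b
      ≡⟨ rhs b c₀ c₁ ⟩
    + 1 ℤ.* (- (+ 2) ℤ.* c₀) ℤ.+ (+ 1 ℤ.* (- (+ 2) ℤ.* c₁) ℤ.+ + 0) ∎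
    where
    a  = + countAdm (2+ m)
    b  = + countAdm (suc (2+ m))
    c₀ = + catalan m
    c₁ = + catalan (suc m)
    lhs : ∀ a b → - (+ 2) ℤ.* ((a ℤ.+ a) ℤ.- + 0) ℤ.+ (+ 1 ℤ.* ((b ℤ.+ b) ℤ.- + 0) ℤ.+ + 0)
                    ≡ - (+ 2) ℤ.* (a ℤ.+ a) ℤ.+ + 2 ℤ.* b
    lhs = solve-∀
    rhs : ∀ b c₀ c₁ → - (+ 2) ℤ.* (b ℤ.+ (c₀ ℤ.+ c₁)) ℤ.+ + 2 ℤ.* b
                        ≡ + 1 ℤ.* (- (+ 2) ℤ.* c₀) ℤ.+ (+ 1 ℤ.* (- (+ 2) ℤ.* c₁) ℤ.+ + 0)
    rhs = solve-∀

mainTheorem2 : Σ Series IsSqrt1-4z²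
    × ((S : Series) → IsSqrt1-4z² S → (n : ℕ) →
        (poly (+ 1 ∷ - (+ 2) ∷ []) ⋆ ((G ⊕ G) ⊖ poly (+ 1 ∷ - (+ 1) ∷ []))) n
          ≡ (poly (+ 1 ∷ + 1 ∷ []) ⋆ S) n)
mainTheorem2 = (√1-4z² , isSqrt) , λ S isSqrtS n → begin
  (poly (+ 1 ∷ - (+ 2) ∷ []) ⋆ ((G ⊕ G) ⊖ poly (+ 1 ∷ - (+ 1) ∷ []))) n
    ≡⟨ admissible-gf n ⟩
  (poly (+ 1 ∷ + 1 ∷ []) ⋆ √1-4z²) n
    ≡⟨ ⋆-congʳ (poly (+ 1 ∷ + 1 ∷ [])) (isSqrt1-4z²-unique isSqrt isSqrtS) n ⟩
  (poly (+ 1 ∷ + 1 ∷ []) ⋆ S) n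
    ∎
  where
  open ≡-Reasoning
  isSqrt : IsSqrt1-4z² √1-4z²
  isSqrt = refl , √1-4z²-squared
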